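{- Consider a path $p$ operated by the Linear MIMD Protocol with parameters $\alpha_p>0$, $\beta_p\in(0,1)$ and starting rate $f_0(p)>0$. Then \[ \sum_{t\in T'_p}\mathsf{rcvd}(p,t) \;\ge\; \Big(\frac{\beta_p}{\alpha_p}-1\Big)\sum_{t\in T'_p}\mathsf{lost}(p,t) \;-\; \alpha_p^{ -1}(d_p+1)\,f_0(p). \]
   Context: Time is discrete, $t\in\{0,1,2,\dots\}$, and packet counts are nonnegative real numbers (fluid model). A connection is a path $p$ with an active time interval $T_p=\{s_p,s_p+1,\dots,e_p\}$ and an integer round-trip delay $d_p\ge 0$: a packet injected on $p$ at time $t$, if not discarded, is received at time $t+d_p$. Let $T'_p=T_p+d_p=\{s_p+d_p,\dots,e_p+d_p\}$. Let $\mathsf{sent}(p,t)\ge 0$ be the amount injected at $p$'s source at time $t$ (zero for $t\notin T_p$), $\mathsf{rcvd}(p,t)$ the amount received at $p$'s destination at time $t$, and $\mathsf{lost}(p,t)=\mathsf{sent}(p,t-d_p)-\mathsf{rcvd}(p,t)\ge 0$. Define the lost-to-sent ratio $\mathsf{lsr}(p,t)=\mathsf{lost}(p,t)/\mathsf{sent}(p,t-d_p)$. The Linear MIMD Protocol on path $p$, with parameters $\alpha_p>0$, $\beta_p\in(0,1)$ and starting rate $f_0(p)>0$, sets $\mathsf{sent}(p,t)=f_0(p)$ for $t=s_p,\dots,s_p+d_p$, and for $t=s_p+1+d_p,\dots,e_p$ sets $\mathsf{sent}(p,t)=\mathsf{sent}(p,t-1-d_p)\,\big[1+\alpha_p-\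beta_p\,\mathsf{lsr}(p,t-1)\big]$.
   Formalization: The packet counts sent and received and the parameters $\alpha_p$, $\beta_p$ and $f_0(p)$ are rational numbers instead of real numbers. -}

module Defs where

open import Data.Nat as ℕ using (ℕ; zero; suc)
open import Data.Rational using (ℚ; 0ℚ; 1ℚ; _+_; _-_; _*_; _≤_; _<_; 1/_; ≢-nonZero)
open import Data.Rational.Properties using (_≟_)
open import Data.Sum using (_⊎_)
open import Relation.Binary.PropositionalEquality using (_≡_)
open import Relation.Nullary using (yes; no)

-- Reciprocal, with the (never used) convention 1/0 := 0.
recip : ℚ → ℚ
recip q with q ≟ 0ℚ
... | yes _ = 0ℚ
... | no q≢0 = 1/_ q {{≢-nonZero q≢0}}

ℕ→ℚ : ℕ → ℚ
ℕ→ℚ zero = 0ℚ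
ℕ→ℚ (suc n) = 1ℚ + ℕ→ℚ n

-- Σ_{t = a}^{b} f t   (inclusive interval; empty if b < a)
sumFromTo : (ℕ → ℚ) → ℕ → ℕ → ℚ
sumFromTo f a b = go (suc b ℕ.∸ a) a
  where
  go : ℕ → ℕ → ℚ
  go zero    _ = 0ℚ
  go (suc k) t = f t + go k (suc t)

-- A connection (path p): active interval T_p = {s,...,e}, delay d.
record Connection : Set where
  field
    s e d : ℕ
    s≤e   : s ℕ.≤ e

module _ (c : Connection) (sent rcvd : ℕ → ℚ) where
  open Connection c

  -- lost(p,t) = sent(p,t-d) - rcvd(p,t)   (used for t ∈ T'_p, so t ≥ d)
  lost : ℕ → ℚ
  lost t = sent (t ℕ.∸ d) - rcvd t

  lsr : ℕ → ℚ
  lsr t = lost t * recip (sent (t ℕ.∸ d))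

  sumT' : (ℕ → ℚ) → ℚ
  sumT' f = sumFromTo f (s ℕ.+ d) (e ℕ.+ d)

  record IsLinearMIMDRun (α β f₀ : ℚ) : Set where
    field
      sent-nonneg   : ∀ t → 0ℚ ≤ sent t
      sent-outside  : ∀ t → (t ℕ.< s ⊎ e ℕ.< t) → sent t ≡ 0ℚ
      rcvd-nonneg   : ∀ t → s ℕ.+ d ℕ.≤ t → t ℕ.≤ e ℕ.+ d → 0ℚ ≤ rcvd t
      lost-nonneg   : ∀ t → s ℕ.+ d ℕ.≤ t → t ℕ.≤ e ℕ.+ d → 0ℚ ≤ lost t
      sent-start    : ∀ t → s ℕ.≤ t → t ℕ.≤ s ℕ.+ d → t ℕ.≤ e → sent t ≡ f₀
      sent-update   : ∀ t → suc (s ℕ.+ d) ℕ.≤ t → t ℕ.≤ e →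
                      sent t ≡ sent (t ℕ.∸ suc d) * ((1ℚ + α) - β * lsr (t ℕ.∸ 1))

-- For t ∈ T' write x(t) = sent(t − d) and ℓ(t) = lost(t). The MIMD update makes
-- sent(t + 1) + β ℓ(t) ≤ (1 + α) x(t) while t + 1 is active (with equality when x(t) ≠ 0), and
-- afterwards sent(t + 1) = 0 and β ℓ(t) ≤ ℓ(t) ≤ x(t). Summing over T' gives
-- Σ sent(t + 1) + β Σ ℓ ≤ (1 + α) Σ x. Both sums of sent run over the same sequence, shifted by
-- d + 1 slots, and the d + 1 slots by which Σ x starts earlier carry at most f₀ each, so
-- Σ x ≤ (d + 1) f₀ + Σ sent(t + 1). Hence β Σ ℓ ≤ α Σ x + (d + 1) f₀; as Σ x = Σ rcvd + Σ ℓ,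
-- dividing by α gives the bound.
module Submission where

open import Defs
open import Data.Nat using (ℕ; suc)
open import Data.Rational using (ℚ; 0ℚ; 1ℚ; _+_; _-_; _*_; _≤_; _<_)

open import Data.List using (_∷_; [])
open import Data.Nat as ℕ using (zero; _∸_; _≤?_; s≤s; z<s)
import Data.Nat.Properties as ℕ
open import Data.Rational using (-_; ≢-nonZero; positive; nonNegative)
open import Data.Rational.Properties
  using ( _≟_; ≤-refl; ≤-trans; ≤-reflexive; <⇒≤; +-mono-≤; +-monoˡ-≤; +-monoʳ-≤
        ; +-identityˡ; +-identityʳ; +-assoc; *-identityˡ; *-zeroˡ; *-zeroʳ
        ; *-distribˡ-+; *-distribʳ-+; *-inverseʳ; *-monoˡ-≤-nonNeg; *-monoʳ-≤-nonNeg
        ; neg-antimono-≤; 1/pos⇒pos; positive⁻¹; <⇒≢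
        ; +-*-commutativeRing; +-0-commutativeMonoid; module ≤-Reasoning )
open import Data.Sum using (inj₂)
open import Algebra.Bundles using (CommutativeMonoid)
open import Algebra.Properties.CommutativeSemigroup
  (CommutativeMonoid.commutativeSemigroup +-0-commutativeMonoid) using (interchange)
open import Level using (0ℓ)
open import Relation.Binary.PropositionalEquality
open import Relation.Nullary using (yes; no; contradiction)
open import Relation.Nullary.Decidable using (dec⇒maybe)
open import Tactic.RingSolver using (solve)
open import Tactic.RingSolver.Core.AlmostCommutativeRing
  using (AlmostCommutativeRing; fromCommutativeRing)

ℚ-ring : AlmostCommutativeRing 0ℓ 0ℓ
ℚ-ring = fromCommutativeRing +-*-commutativeRing (λ x → dec⇒maybe (0ℚ ≟ x))

sumFrom : (ℕ → ℚ) → ℕ → ℕ → ℚ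
sumFrom f a zero    = 0ℚ
sumFrom f a (suc n) = f a + sumFrom f (suc a) n

sumFromTo-unfold : ∀ f {a b} → a ℕ.≤ b → sumFromTo f a b ≡ f a + sumFromTo f (suc a) b
sumFromTo-unfold f a≤b rewrite ℕ.+-∸-assoc 1 a≤b = refl

sumFromTo≡sumFrom : ∀ f a b {n} → suc b ∸ a ≡ n → sumFromTo f a b ≡ sumFrom f a n
sumFromTo≡sumFrom f a b {zero}  len rewrite len = refl
sumFromTo≡sumFrom f a b {suc n} len = begin
  sumFromTo f a b              ≡⟨ sumFromTo-unfold f a≤b ⟩
  f a + sumFromTo f (suc a) b  ≡⟨ cong (f a +_) (sumFromTo≡sumFrom f (suc a) b b∸a≡n) ⟩
  f a + sumFrom f (suc a) n    ∎
  where
  open ≡-Reasoning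
  a≤b : a ℕ.≤ b
  a≤b = ℕ.≤-pred (ℕ.m∸n≢0⇒n<m (λ len′ → ℕ.0≢1+n (trans (sym len′) len)))
  b∸a≡n : b ∸ a ≡ n
  b∸a≡n = ℕ.suc-injective (trans (sym (ℕ.+-∸-assoc 1 a≤b)) len)

sumFrom-cong : ∀ {f g} → (∀ t → f t ≡ g t) → ∀ a n → sumFrom f a n ≡ sumFrom g a n
sumFrom-cong f≗g a zero    = refl
sumFrom-cong f≗g a (suc n) = cong₂ _+_ (f≗g a) (sumFrom-cong f≗g (suc a) n)

sumFrom-+ : ∀ f g a n → sumFrom (λ t → f t + g t) a n ≡ sumFrom f a n + sumFrom g a n
sumFrom-+ f g a zero    = refl
sumFrom-+ f g a (suc n) = trans (cong ((f a + g a) +_) (sumFrom-+ f g (suc a) n))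
                                (interchange (f a) (g a) (sumFrom f (suc a) n) (sumFrom g (suc a) n))

sumFrom-*ˡ : ∀ c f a n → sumFrom (λ t → c * f t) a n ≡ c * sumFrom f a n
sumFrom-*ˡ c f a zero    = sym (*-zeroʳ c)
sumFrom-*ˡ c f a (suc n) = trans (cong (c * f a +_) (sumFrom-*ˡ c f (suc a) n))
                                 (sym (*-distribˡ-+ c (f a) (sumFrom f (suc a) n)))

sumFrom-const : ∀ c a n → sumFrom (λ _ → c) a n ≡ ℕ→ℚ n * c
sumFrom-const c a zero    = sym (*-zeroˡ c)
sumFrom-const c a (suc n) = begin
  c + sumFrom (λ _ → c) (suc a) n  ≡⟨ cong (c +_) (sumFrom-const c (suc a) n) ⟩
  c + ℕ→ℚ n * c                    ≡⟨ cong (_+ ℕ→ℚ n * c) (sym (*-identityˡ c)) ⟩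
  1ℚ * c + ℕ→ℚ n * c               ≡⟨ sym (*-distribʳ-+ c 1ℚ (ℕ→ℚ n)) ⟩
  (1ℚ + ℕ→ℚ n) * c                 ∎
  where open ≡-Reasoning

sumFrom-++ : ∀ f a m n → sumFrom f a (m ℕ.+ n) ≡ sumFrom f a m + sumFrom f (a ℕ.+ m) n
sumFrom-++ f a zero    n = begin
  sumFrom f a n               ≡⟨ cong (λ b → sumFrom f b n) (sym (ℕ.+-identityʳ a)) ⟩
  sumFrom f (a ℕ.+ 0) n       ≡⟨ sym (+-identityˡ _) ⟩
  0ℚ + sumFrom f (a ℕ.+ 0) n  ∎
  where open ≡-Reasoning
sumFrom-++ f a (suc m) n = begin
  f a + sumFrom f (suc a) (m ℕ.+ n)
    ≡⟨ cong (f a +_) (sumFrom-++ f (suc a) m n) ⟩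
  f a + (sumFrom f (suc a) m + sumFrom f (suc a ℕ.+ m) n)
    ≡⟨ sym (+-assoc (f a) _ _) ⟩
  (f a + sumFrom f (suc a) m) + sumFrom f (suc (a ℕ.+ m)) n
    ≡⟨ cong (λ b → f a + sumFrom f (suc a) m + sumFrom f b n) (sym (ℕ.+-suc a m)) ⟩
  (f a + sumFrom f (suc a) m) + sumFrom f (a ℕ.+ suc m) n
    ∎
  where open ≡-Reasoning

sumFrom-suc : ∀ f a n → sumFrom (λ t → f (suc t)) a n ≡ sumFrom f (suc a) n
sumFrom-suc f a zero    = refl
sumFrom-suc f a (suc n) = cong (f (suc a) +_) (sumFrom-suc f (suc a) n)

sumFrom-∸ : ∀ f a d n → sumFrom (λ t → f (t ∸ d)) (a ℕ.+ d) n ≡ sumFrom f a n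
sumFrom-∸ f a d zero    = refl
sumFrom-∸ f a d (suc n) = cong₂ _+_ (cong f (ℕ.m+n∸n≡m a d)) (sumFrom-∸ f (suc a) d n)

sumFrom-mono : ∀ {f g} a n → (∀ t → a ℕ.≤ t → t ℕ.< a ℕ.+ n → f t ≤ g t) →
               sumFrom f a n ≤ sumFrom g a n
sumFrom-mono a zero    f≤g = ≤-refl
sumFrom-mono a (suc n) f≤g =
  +-mono-≤ (f≤g a ℕ.≤-refl (ℕ.m<m+n a z<s))
           (sumFrom-mono (suc a) n λ t a<t t<1+a+n →
             f≤g t (ℕ.<⇒≤ a<t) (subst (t ℕ.<_) (sym (ℕ.+-suc a n)) t<1+a+n))

sumFrom-nonNeg : ∀ {f} → (∀ t → 0ℚ ≤ f t) → ∀ a n → 0ℚ ≤ sumFrom f a n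
sumFrom-nonNeg 0≤f a zero    = ≤-refl
sumFrom-nonNeg 0≤f a (suc n) = +-mono-≤ (0≤f a) (sumFrom-nonNeg 0≤f (suc a) n)

sumFrom-≤-window : ∀ {f c} a k n → (∀ t → 0ℚ ≤ f t) → (∀ t → a ℕ.≤ t → t ℕ.< a ℕ.+ k → f t ≤ c) →
                   sumFrom f a n ≤ ℕ→ℚ k * c + sumFrom f (a ℕ.+ k) n
sumFrom-≤-window {f} {c} a k n 0≤f f≤c = begin
  sumFrom f a n                                 ≡⟨ sym (+-identityʳ _) ⟩
  sumFrom f a n + 0ℚ                            ≤⟨ +-monoʳ-≤ (sumFrom f a n) (sumFrom-nonNeg 0≤f (a ℕ.+ n) k) ⟩
  sumFrom f a n + sumFrom f (a ℕ.+ n) k         ≡⟨ sym (sumFrom-++ f a n k) ⟩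
  sumFrom f a (n ℕ.+ k)                         ≡⟨ cong (sumFrom f a) (ℕ.+-comm n k) ⟩
  sumFrom f a (k ℕ.+ n)                         ≡⟨ sumFrom-++ f a k n ⟩
  sumFrom f a k + sumFrom f (a ℕ.+ k) n         ≤⟨ +-monoˡ-≤ (sumFrom f (a ℕ.+ k) n) (sumFrom-mono a k f≤c) ⟩
  sumFrom (λ _ → c) a k + sumFrom f (a ℕ.+ k) n ≡⟨ cong (_+ sumFrom f (a ℕ.+ k) n) (sumFrom-const c a k) ⟩
  ℕ→ℚ k * c + sumFrom f (a ℕ.+ k) n             ∎
  where open ≤-Reasoning

*-recipʳ : ∀ {x} → x ≢ 0ℚ → x * recip x ≡ 1ℚ
*-recipʳ {x} x≢0 with x ≟ 0ℚ
... | yes x≡0 = contradiction x≡0 x≢0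
... | no  x≢0 = *-inverseʳ x {{≢-nonZero x≢0}}

recip-nonNeg : ∀ {x} → 0ℚ < x → 0ℚ ≤ recip x
recip-nonNeg {x} 0<x with x ≟ 0ℚ
... | yes _   = ≤-refl
... | no  x≢0 = <⇒≤ (positive⁻¹ _ {{1/pos⇒pos x {{positive 0<x}}}})

x-y≤x : ∀ x {y} → 0ℚ ≤ y → x - y ≤ x
x-y≤x x {y} 0≤y = begin
  x + - y   ≤⟨ +-monoʳ-≤ x (neg-antimono-≤ 0≤y) ⟩
  x + - 0ℚ  ≡⟨ +-identityʳ x ⟩
  x         ∎
  where open ≤-Reasoning

mimd-update-≤ : ∀ α {β x ℓ} → 0ℚ ≤ β → ℓ ≤ x →
                x * ((1ℚ + α) - β * (ℓ * recip x)) + β * ℓ ≤ (1ℚ + α) * x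
-- Testing 0ℚ ≟ x rather than x ≟ 0ℚ keeps `with` from abstracting the test inside recip x.
mimd-update-≤ α {β} {x} {ℓ} 0≤β ℓ≤x with 0ℚ ≟ x
... | yes refl = begin
  0ℚ * u + β * ℓ  ≡⟨ cong (_+ β * ℓ) (*-zeroˡ u) ⟩
  0ℚ + β * ℓ       ≡⟨ +-identityˡ (β * ℓ) ⟩
  β * ℓ            ≤⟨ *-monoˡ-≤-nonNeg β {{nonNegative 0≤β}} ℓ≤x ⟩
  β * 0ℚ           ≡⟨ trans (*-zeroʳ β) (sym (*-zeroʳ (1ℚ + α))) ⟩
  (1ℚ + α) * 0ℚ    ∎
  where
  open ≤-Reasoning
  u = (1ℚ + α) - β * (ℓ * recip 0ℚ)
... | no 0≢x = ≤-reflexive (begin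
  x * ((1ℚ + α) - β * (ℓ * recip x)) + β * ℓ  ≡⟨ expand α β x ℓ (recip x) ⟩
  (1ℚ + α) * x + β * ℓ * (1ℚ - x * recip x)   ≡⟨ cong (λ y → (1ℚ + α) * x + β * ℓ * (1ℚ - y)) (*-recipʳ (≢-sym 0≢x)) ⟩
  (1ℚ + α) * x + β * ℓ * (1ℚ - 1ℚ)            ≡⟨ cancel α β x ℓ ⟩
  (1ℚ + α) * x                                ∎)
  where
  open ≡-Reasoning
  expand : ∀ α β x ℓ r → x * ((1ℚ + α) - β * (ℓ * r)) + β * ℓ ≡ (1ℚ + α) * x + β * ℓ * (1ℚ - x * r)
  expand α β x ℓ r = solve (α ∷ β ∷ x ∷ ℓ ∷ r ∷ []) ℚ-ring
  cancel : ∀ α β x ℓ → (1ℚ + α) * x + β * ℓ * (1ℚ - 1ℚ) ≡ (1ℚ + α) * x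
  cancel α β x ℓ = solve (α ∷ β ∷ x ∷ ℓ ∷ []) ℚ-ring

mimd-inactive-≤ : ∀ {α β x ℓ} → 0ℚ ≤ α → β ≤ 1ℚ → 0ℚ ≤ ℓ → ℓ ≤ x → β * ℓ ≤ (1ℚ + α) * x
mimd-inactive-≤ {α} {β} {x} {ℓ} 0≤α β≤1 0≤ℓ ℓ≤x = begin
  β * ℓ          ≤⟨ *-monoʳ-≤-nonNeg ℓ {{nonNegative 0≤ℓ}} β≤1 ⟩
  1ℚ * ℓ         ≡⟨ *-identityˡ ℓ ⟩
  ℓ              ≤⟨ ℓ≤x ⟩
  x              ≡⟨ sym (*-identityˡ x) ⟩
  1ℚ * x         ≤⟨ *-monoʳ-≤-nonNeg x {{nonNegative (≤-trans 0≤ℓ ℓ≤x)}} 1≤1+α ⟩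
  (1ℚ + α) * x   ∎
  where
  open ≤-Reasoning
  1≤1+α : 1ℚ ≤ 1ℚ + α
  1≤1+α = subst (_≤ 1ℚ + α) (+-identityʳ 1ℚ) (+-monoʳ-≤ 1ℚ 0≤α)

x+y≤[1+α]z⇒z≤w+x⇒y≤αz+w : ∀ α x y z w → x + y ≤ (1ℚ + α) * z → z ≤ w + x → y ≤ α * z + w
x+y≤[1+α]z⇒z≤w+x⇒y≤αz+w α x y z w x+y≤[1+α]z z≤w+x = begin
  y                     ≡⟨ solve (x ∷ y ∷ []) ℚ-ring ⟩
  (x + y) - x           ≤⟨ +-monoˡ-≤ (- x) x+y≤[1+α]z ⟩
  (1ℚ + α) * z - x      ≡⟨ solve (α ∷ x ∷ z ∷ []) ℚ-ring ⟩
  α * z + (z - x)       ≤⟨ +-monoʳ-≤ (α * z) (+-monoˡ-≤ (- x) z≤w+x) ⟩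
  α * z + ((w + x) - x) ≡⟨ solve (α ∷ x ∷ z ∷ w ∷ []) ℚ-ring ⟩
  α * z + w             ∎
  where open ≤-Reasoning

βℓ≤α[r+ℓ]+nf⇒[βα⁻¹-1]ℓ-α⁻¹nf≤r : ∀ α {α⁻¹} β ℓ r n f → α * α⁻¹ ≡ 1ℚ → 0ℚ ≤ α⁻¹ →
                                 β * ℓ ≤ α * (r + ℓ) + n * f →
                                 (β * α⁻¹ - 1ℚ) * ℓ - α⁻¹ * n * f ≤ r
βℓ≤α[r+ℓ]+nf⇒[βα⁻¹-1]ℓ-α⁻¹nf≤r α {α⁻¹} β ℓ r n f αα⁻¹≡1 0≤α⁻¹ βℓ≤α[r+ℓ]+nf = begin
  (β * α⁻¹ - 1ℚ) * ℓ - α⁻¹ * n * f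
    ≡⟨ solve (α⁻¹ ∷ β ∷ ℓ ∷ n ∷ f ∷ []) ℚ-ring ⟩
  α⁻¹ * (β * ℓ) - (ℓ + α⁻¹ * (n * f))
    ≤⟨ +-monoˡ-≤ _ (*-monoˡ-≤-nonNeg α⁻¹ {{nonNegative 0≤α⁻¹}} βℓ≤α[r+ℓ]+nf) ⟩
  α⁻¹ * (α * (r + ℓ) + n * f) - (ℓ + α⁻¹ * (n * f))
    ≡⟨ solve (α ∷ α⁻¹ ∷ ℓ ∷ r ∷ n ∷ f ∷ []) ℚ-ring ⟩
  (α * α⁻¹) * (r + ℓ) - ℓ
    ≡⟨ cong (λ y → y * (r + ℓ) - ℓ) αα⁻¹≡1 ⟩
  1ℚ * (r + ℓ) - ℓ
    ≡⟨ solve (ℓ ∷ r ∷ []) ℚ-ring ⟩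
  r ∎
  where open ≤-Reasoning

module _ {c : Connection} {sent rcvd : ℕ → ℚ} {α β f₀ : ℚ} (run : IsLinearMIMDRun c sent rcvd α β f₀)
         (0≤α : 0ℚ ≤ α) (0≤β : 0ℚ ≤ β) (β≤1 : β ≤ 1ℚ) (0≤f₀ : 0ℚ ≤ f₀) where
  open Connection c
  open IsLinearMIMDRun run

  ℓ : ℕ → ℚ
  ℓ = lost c sent rcvd

  #T' : ℕ
  #T' = suc (e ℕ.+ d) ∸ (s ℕ.+ d)

  ΣT' : (ℕ → ℚ) → ℚ
  ΣT' f = sumFrom f (s ℕ.+ d) #T'

  sumT'≡ΣT' : ∀ f → sumT' c sent rcvd f ≡ ΣT' f
  sumT'≡ΣT' f = sumFromTo≡sumFrom f (s ℕ.+ d) (e ℕ.+ d) refl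

  <s+d+#T'⇒≤e+d : ∀ {u} → u ℕ.< s ℕ.+ d ℕ.+ #T' → u ℕ.≤ e ℕ.+ d
  <s+d+#T'⇒≤e+d {u} u<s+d+#T' =
    ℕ.≤-pred (subst (u ℕ.<_) (ℕ.m+[n∸m]≡n (ℕ.m≤n⇒m≤1+n (ℕ.+-monoˡ-≤ d s≤e))) u<s+d+#T')

  lost≤sent : ∀ u → s ℕ.+ d ℕ.≤ u → u ℕ.≤ e ℕ.+ d → ℓ u ≤ sent (u ∸ d)
  lost≤sent u lo hi = x-y≤x (sent (u ∸ d)) (rcvd-nonneg u lo hi)

  slot-≤ : ∀ u → s ℕ.+ d ℕ.≤ u → u ℕ.≤ e ℕ.+ d → sent (suc u) + β * ℓ u ≤ (1ℚ + α) * sent (u ∸ d)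
  slot-≤ u lo hi with suc u ≤? e
  ... | yes u<e = begin
    sent (suc u) + β * ℓ u
      ≡⟨ cong (_+ β * ℓ u) (sent-update (suc u) (s≤s lo) u<e) ⟩
    sent (u ∸ d) * ((1ℚ + α) - β * (ℓ u * recip (sent (u ∸ d)))) + β * ℓ u
      ≤⟨ mimd-update-≤ α 0≤β (lost≤sent u lo hi) ⟩
    (1ℚ + α) * sent (u ∸ d) ∎
    where open ≤-Reasoning
  ... | no u≮e = begin
    sent (suc u) + β * ℓ u   ≡⟨ cong (_+ β * ℓ u) (sent-outside (suc u) (inj₂ (ℕ.≰⇒> u≮e))) ⟩
    0ℚ + β * ℓ u             ≡⟨ +-identityˡ (β * ℓ u) ⟩
    β * ℓ u                  ≤⟨ mimd-inactive-≤ 0≤α β≤1 (lost-nonneg u lo hi) (lost≤sent u lo hi) ⟩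
    (1ℚ + α) * sent (u ∸ d)  ∎
    where open ≤-Reasoning

  Σslot-≤ : ΣT' (λ u → sent (suc u)) + β * ΣT' ℓ ≤ (1ℚ + α) * ΣT' (λ u → sent (u ∸ d))
  Σslot-≤ = begin
    ΣT' (λ u → sent (suc u)) + β * ΣT' ℓ
      ≡⟨ cong (ΣT' (λ u → sent (suc u)) +_) (sym (sumFrom-*ˡ β ℓ (s ℕ.+ d) #T')) ⟩
    ΣT' (λ u → sent (suc u)) + ΣT' (λ u → β * ℓ u)
      ≡⟨ sym (sumFrom-+ (λ u → sent (suc u)) (λ u → β * ℓ u) (s ℕ.+ d) #T') ⟩
    ΣT' (λ u → sent (suc u) + β * ℓ u)
      ≤⟨ sumFrom-mono (s ℕ.+ d) #T' (λ u lo hi → slot-≤ u lo (<s+d+#T'⇒≤e+d hi)) ⟩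
    ΣT' (λ u → (1ℚ + α) * sent (u ∸ d))
      ≡⟨ sumFrom-*ˡ (1ℚ + α) (λ u → sent (u ∸ d)) (s ℕ.+ d) #T' ⟩
    (1ℚ + α) * ΣT' (λ u → sent (u ∸ d)) ∎
    where open ≤-Reasoning

  sent≤f₀ : ∀ t → s ℕ.≤ t → t ℕ.< s ℕ.+ suc d → sent t ≤ f₀
  sent≤f₀ t lo hi with t ≤? e
  ... | yes t≤e = ≤-reflexive (sent-start t lo (ℕ.≤-pred (subst (t ℕ.<_) (ℕ.+-suc s d) hi)) t≤e)
  ... | no  t≰e = subst (_≤ f₀) (sym (sent-outside t (inj₂ (ℕ.≰⇒> t≰e)))) 0≤f₀

  Σsent-≤-window : ΣT' (λ u → sent (u ∸ d)) ≤ ℕ→ℚ (suc d) * f₀ + ΣT' (λ u → sent (suc u))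
  Σsent-≤-window = begin
    ΣT' (λ u → sent (u ∸ d))             ≡⟨ sumFrom-∸ sent s d #T' ⟩
    sumFrom sent s #T'                   ≤⟨ sumFrom-≤-window s (suc d) #T' sent-nonneg sent≤f₀ ⟩
    D + sumFrom sent (s ℕ.+ suc d) #T'   ≡⟨ cong (λ a → D + sumFrom sent a #T') (ℕ.+-suc s d) ⟩
    D + sumFrom sent (suc (s ℕ.+ d)) #T' ≡⟨ cong (D +_) (sym (sumFrom-suc sent (s ℕ.+ d) #T')) ⟩
    D + ΣT' (λ u → sent (suc u))         ∎
    where
    open ≤-Reasoning
    D = ℕ→ℚ (suc d) * f₀

  Σsent≡Σrcvd+Σlost : ΣT' (λ u → sent (u ∸ d)) ≡ ΣT' rcvd + ΣT' ℓ
  Σsent≡Σrcvd+Σlost =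
    trans (sumFrom-cong (λ u → x≡r+[x-r] (sent (u ∸ d)) (rcvd u)) (s ℕ.+ d) #T')
          (sumFrom-+ rcvd ℓ (s ℕ.+ d) #T')
    where
    x≡r+[x-r] : ∀ x r → x ≡ r + (x - r)
    x≡r+[x-r] x r = solve (x ∷ r ∷ []) ℚ-ring

  loss-bound : β * sumT' c sent rcvd ℓ
               ≤ α * (sumT' c sent rcvd rcvd + sumT' c sent rcvd ℓ) + ℕ→ℚ (suc d) * f₀
  loss-bound rewrite sumT'≡ΣT' ℓ | sumT'≡ΣT' rcvd | sym Σsent≡Σrcvd+Σlost =
    x+y≤[1+α]z⇒z≤w+x⇒y≤αz+w α (ΣT' (λ u → sent (suc u))) (β * ΣT' ℓ) (ΣT' (λ u → sent (u ∸ d)))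
      (ℕ→ℚ (suc d) * f₀) Σslot-≤ Σsent-≤-window

lemma1 : (c : Connection) (α β f₀ : ℚ) → 0ℚ < α → 0ℚ < β → β < 1ℚ → 0ℚ < f₀ →
           (sent rcvd : ℕ → ℚ) → IsLinearMIMDRun c sent rcvd α β f₀ →
           ((β * recip α) - 1ℚ) * sumT' c sent rcvd (lost c sent rcvd)
             - recip α * ℕ→ℚ (suc (Connection.d c)) * f₀
           ≤ sumT' c sent rcvd rcvd
lemma1 c α β f₀ 0<α 0<β β<1 0<f₀ sent rcvd run =
  βℓ≤α[r+ℓ]+nf⇒[βα⁻¹-1]ℓ-α⁻¹nf≤r α β (sumT' c sent rcvd (lost c sent rcvd)) (sumT' c sent rcvd rcvd)
    (ℕ→ℚ (suc (Connection.d c))) f₀ (*-recipʳ (≢-sym (<⇒≢ 0<α))) (recip-nonNeg 0<α)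
    (loss-bound run (<⇒≤ 0<α) (<⇒≤ 0<β) (<⇒≤ β<1) (<⇒≤ 0<f₀))
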